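{- For $n\in\mathbb{Z}_{>0}$, $s_1,\dots,s_n\in\mathbb{Z}_{>0}$ and $p\in\mathbb{Z}_{\ge0}$, the base polytope $B(M(\mathcal{B}_{s_1,\dots,s_n,p}))$ is unimodularly equivalent to the stable set polytope $\mathrm{Stab}_{G_{s_1,\dots,s_n,p}}$.
   Context: $M(G)$ is the graphic matroid of a graph $G$ (bases = spanning forests), $B(M)=\mathrm{conv}\{\chi_B: B\text{ basis}\}$. $\mathcal{B}_{s_1,\dots,s_n,p}$ is the multigraph with vertices $v_1,\dots,v_{n+1},u_1,\dots,u_p$, having $s_i+1$ parallel edges between $v_i$ and $v_{i+1}$ for each $i\in[1,n]$, together with the path $v_1,u_1,\dots,u_p,v_{n+1}$ of length $p+1$. $G_{s_1,\dots,s_n,p}$ is the simple graph on vertex set $\{m_1,\dots,m_n,u_1,\dots,u_p\}\cup\bigcup_{i=1}^n\{v_{i,1},\dots,v_{i,s_i}\}$ whose edges are those of the clique on $\{m_1,\dots,m_n,u_1,\dots,u_p\}$ (a $K_{p+n}$) and of the cliques on $\{v_{i,1},\dots,v_{i,s_i},m_i\}$ (a $K_{s_i+1}$) for each $i$. For a simple graph $H$, $\mathrm{Stab}_H=\mathrm{conv}\{\chi_T: T\subset V(H)\text{ stable}\}\subset\mathbb{R}^{V(H)}$. Unimodular equivalence of lattice polytopes, possibly in different ambient spaces, means an affine isomorphism between their affine hulls mapping lattice points bijectively onto lattice points and one polytope onto the other.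
   Formalization: Both polytopes, their affine hulls and the affine isomorphism between the hulls are taken over ℚ instead of ℝ, so all points have rational coordinates. -}

module Defs where

open import Data.Nat using (ℕ; zero; suc; _≤_)
open import Data.Integer using (ℤ)
open import Data.Rational using (ℚ; 0ℚ; 1ℚ; _/_) renaming (_+_ to _+q_; _*_ to _*q_; _≤_ to _≤q_)
open import Data.Fin using (Fin; zero; suc; fromℕ; inject₁)
open import Data.Bool using (Bool; true; false; if_then_else_)
open import Data.List using (List; []; _∷_; map; foldr)
open import Data.List.Relation.Unary.All using (All)
open import Data.Product using (Σ; _×_; _,_; proj₁; proj₂)
open import Data.Sum using (_⊎_)
open import Relation.Binary.PropositionalEquality using (_≡_)
open import Relation.Nullary using (¬_)
open import Data.Unit using (⊤)
open import Data.Empty using (⊥)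

sumℚ : List ℚ → ℚ
sumℚ = foldr _+q_ 0ℚ

χ : {X : Set} → (X → Bool) → X → ℚ
χ B x = if B x then 1ℚ else 0ℚ

combV : {X : Set} → List (ℚ × (X → ℚ)) → X → ℚ
combV L x = sumℚ (map (λ cv → proj₁ cv *q proj₂ cv x) L)

coeffSum : {A : Set} → List (ℚ × A) → ℚ
coeffSum L = sumℚ (map proj₁ L)

combχ : {X : Set} → List (ℚ × (X → Bool)) → X → ℚ
combχ L = combV (map (λ cB → proj₁ cB , χ (proj₂ cB)) L)

InConv : {X : Set} → ((X → Bool) → Set) → (X → ℚ) → Set
InConv {X} S x = Σ (List (ℚ × (X → Bool))) λ L →
  All (λ cB → (0ℚ ≤q proj₁ cB) × S (proj₂ cB)) L ×
  (coeffSum L ≡ 1ℚ) × (∀ i → x i ≡ combχ L i)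

-- x ∈ aff { χ_B : S B }  (= affine hull of the polytope conv{χ_B : S B})
InAff : {X : Set} → ((X → Bool) → Set) → (X → ℚ) → Set
InAff {X} S x = Σ (List (ℚ × (X → Bool))) λ L →
  All (λ cB → S (proj₂ cB)) L ×
  (coeffSum L ≡ 1ℚ) × (∀ i → x i ≡ combχ L i)

Integral : {X : Set} → (X → ℚ) → Set
Integral {X} x = ∀ i → Σ ℤ λ z → x i ≡ z / 1

Extensional : {X Y : Set} → ((X → ℚ) → (Y → ℚ)) → Set
Extensional {X} f = ∀ x y → (∀ i → x i ≡ y i) → ∀ j → f x j ≡ f y j

IsAffine : {X Y : Set} → ((X → ℚ) → (Y → ℚ)) → Set
IsAffine {X} f = ∀ (L : List (ℚ × (X → ℚ))) → coeffSum L ≡ 1ℚ →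
  ∀ j → f (combV L) j ≡ combV (map (λ cv → proj₁ cv , f (proj₂ cv)) L) j

-- Unimodular equivalence of P = conv{χ_B : S B} ⊂ ℚ^X and Q = conv{χ_B : T B} ⊂ ℚ^Y:
-- an affine map f that restricts to a bijection aff P → aff Q, maps the
-- lattice points of aff P bijectively onto those of aff Q, and maps P onto Q.
UnimodEquiv : {X Y : Set} → ((X → Bool) → Set) → ((Y → Bool) → Set) → Set
UnimodEquiv {X} {Y} S T = Σ ((X → ℚ) → (Y → ℚ)) λ f →
  IsAffine f × Extensional f ×
  (∀ x → InAff S x → InAff T (f x)) ×
  (∀ x y → InAff S x → InAff S y → (∀ j → f x j ≡ f y j) → ∀ i → x i ≡ y i) ×
  (∀ y → InAff T y → Σ (X → ℚ) λ x → InAff S x × (∀ j → f x j ≡ y j)) ×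
  (∀ x → InAff S x → (Integral x → Integral (f x)) × (Integral (f x) → Integral x)) ×
  (∀ x → InConv S x → InConv T (f x)) ×
  (∀ y → InConv T y → Σ (X → ℚ) λ x → InConv S x × (∀ j → f x j ≡ y j))

record Multigraph : Set₁ where
  field
    V : Set
    E : Set
    ends : E → V × V
open Multigraph public

Without : (G : Multigraph) → (E G → Bool) → E G → E G → Set
Without G F e e' = (F e' ≡ true) × ¬ (e' ≡ e)

data ConnP (G : Multigraph) (P : E G → Set) : V G → V G → Set where
  here : ∀ {a} → ConnP G P a a
  fwd  : ∀ {c} (e : E G) → P e → ConnP G P (proj₂ (ends G e)) c → ConnP G P (proj₁ (ends G e)) c
  bwd  : ∀ {c} (e : E G) → P e → ConnP G P (proj₁ (ends G e)) c → ConnP G P (proj₂ (ends G e)) c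

-- F is a forest (acyclic): no edge of F lies on a cycle in F, i.e. the
-- endpoints of each edge e ∈ F are not connected in F ∖ {e}
Forest : (G : Multigraph) → (E G → Bool) → Set
Forest G F = ∀ e → F e ≡ true →
  ¬ ConnP G (Without G F e) (proj₁ (ends G e)) (proj₂ (ends G e))

-- F is a spanning forest: a forest with the same connected components as G
SpanningForest : (G : Multigraph) → (E G → Bool) → Set
SpanningForest G F = Forest G F ×
  (∀ e → ConnP G (λ e' → F e' ≡ true) (proj₁ (ends G e)) (proj₂ (ends G e)))

IsBasisM : (G : Multigraph) → (E G → Bool) → Set
IsBasisM = SpanningForest

-- The multigraph 𝓑_{s_1..s_n,p}   (s : Fin n → ℕ, indices 0-based)

data BVert (n p : ℕ) : Set where
  v : Fin (suc n) → BVert n p      -- v (i) is v_{i+1}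
  u : Fin p → BVert n p            -- u (k) is u_{k+1}

data BEdge (n : ℕ) (s : Fin n → ℕ) (p : ℕ) : Set where
  par  : (i : Fin n) → Fin (suc (s i)) → BEdge n s p
  path : Fin (suc p) → BEdge n s p

pick : {A : Set} (q : ℕ) → (Fin q → A) → A → Fin (suc q) → A
pick zero f last zero = last
pick (suc q) f last zero = f zero
pick (suc q) f last (suc j) = pick q (λ k → f (suc k)) last j

-- the path v_1, u_1, ..., u_p, v_{n+1}: its vertices w_0 .. w_{p+1}
pathVert : (n p : ℕ) → Fin (suc (suc p)) → BVert n p
pathVert n p zero = v zero
pathVert n p (suc j) = pick p u (v (fromℕ n)) j

𝓑 : (n : ℕ) → (Fin n → ℕ) → ℕ → Multigraph
𝓑 n s p = record
  { V = BVert n p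
  ; E = BEdge n s p
  ; ends = endsB
  }
  where
  endsB : BEdge n s p → BVert n p × BVert n p
  endsB (par i _) = v (inject₁ i) , v (suc i)
  endsB (path k) = pathVert n p (inject₁ k) , pathVert n p (suc k)

data GVert (n : ℕ) (s : Fin n → ℕ) (p : ℕ) : Set where
  m  : Fin n → GVert n s p
  gu : Fin p → GVert n s p
  vv : (i : Fin n) → Fin (s i) → GVert n s p

Core : {n : ℕ} {s : Fin n → ℕ} {p : ℕ} → GVert n s p → Set
Core (m _) = ⊤
Core (gu _) = ⊤
Core (vv _ _) = ⊥

InBlock : {n : ℕ} {s : Fin n → ℕ} {p : ℕ} → Fin n → GVert n s p → Set
InBlock i x = (x ≡ m i) ⊎ Σ _ λ j → x ≡ vv i j

AdjG : {n : ℕ} {s : Fin n → ℕ} {p : ℕ} → GVert n s p → GVert n s p → Set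
AdjG x y = ¬ (x ≡ y) × ((Core x × Core y) ⊎ Σ _ λ i → InBlock i x × InBlock i y)

StableG : (n : ℕ) (s : Fin n → ℕ) (p : ℕ) → (GVert n s p → Bool) → Set
StableG n s p T = ∀ x y → T x ≡ true → T y ≡ true → ¬ AdjG x y

module Submission where

-- Write e_{i,0}, …, e_{i,s_i} for the edges of bundle i and f_0, …, f_p for the path
-- edges, f_0 at v_1.  A spanning tree of 𝓑 omits exactly one parallel class of the
-- cycle formed by the bundles and the path, and uses one edge of every other class.
-- A stable set of G meets the clique {m_i, u_k} and each block {m_i, v_{i,j}} at most
-- once.  Both are therefore parametrised by the same codes (omitted class, chosen edge
-- per bundle), and the integer affine map y(m_i) = 1 - Σ_k x(e_{i,k}),
-- y(u_k) = 1 - x(f_k), y(v_{i,j}) = x(e_{i,j}) sends the spanning tree with a given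
-- code to the stable set with the same code.  An integer affine map in the opposite
-- direction inverts it on these vertices, so the two maps are mutually inverse on the
-- affine hulls and carry convex hulls and lattice points onto each other.

open import Defs
open import Data.Nat using (ℕ; _≤_; zero; suc; _∸_; _<_; _<ᵇ_) renaming (_+_ to _+ℕ_)
import Data.Nat.Properties as ℕₚ
open import Data.Fin using (Fin; zero; suc; toℕ; fromℕ; inject₁)
import Data.Fin.Properties as Finₚ
open Finₚ using (_≟_)
import Data.Fin.Relation.Unary.Top as Top
open Top using (‵fromℕ; ‵inject₁)
open import Data.Integer using (ℤ; 0ℤ; 1ℤ) renaming (-_ to -ℤ_; _+_ to _+ℤ_)
open import Data.Integer.Solver renaming (module +-*-Solver to ℤ-Solver)
open import Data.Rational using (ℚ; 0ℚ; 1ℚ; _/_; toℚᵘ; _+_; _*_; -_; _-_) renaming (_≤_ to _≤ℚ_)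
import Data.Rational.Properties as ℚₚ
import Data.Rational.Unnormalised as ℚᵘ
import Data.Rational.Unnormalised.Properties as ℚᵘₚ
open import Data.Rational.Solver renaming (module +-*-Solver to ℚ-Solver)
open import Algebra.Properties.Monoid.Sum ℚₚ.+-0-monoid using (sum-syntax; sum-cong-≗; sum-replicate-zero)
open import Data.List using (List; []; _∷_; map)
import Data.List.Properties as Listₚ
open import Data.List.Relation.Unary.All as All using (All; []; _∷_)
open import Data.Product using (Σ; _×_; _,_; proj₁; proj₂)
open import Data.Sum using (_⊎_; inj₁; inj₂)
open import Data.Bool using (Bool; true; false; not; _∧_; _xor_; if_then_else_)
import Data.Bool.Properties as Boolₚ
open import Data.Empty using (⊥; ⊥-elim)
open import Data.Unit using (tt)
open import Function using (_∘_; Equivalence)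
open import Relation.Nullary using (¬_; Dec; yes; no; does)
open import Relation.Nullary.Decidable using (dec-true; dec-false; decidable-stable; map′)
open import Relation.Binary.PropositionalEquality

∑-zero : ∀ q {g : Fin q → ℚ} → (∀ k → g k ≡ 0ℚ) → ∑[ k < q ] g k ≡ 0ℚ
∑-zero q g≗0 = trans (sum-cong-≗ g≗0) (sum-replicate-zero q)

∑-indicator : ∀ {q} (c : Fin q) → ∑[ k < q ] (if does (c ≟ k) then 1ℚ else 0ℚ) ≡ 1ℚ
∑-indicator {suc q} zero    = cong (1ℚ +_) (∑-zero q λ _ → refl)
∑-indicator {suc q} (suc c) = cong (0ℚ +_) (∑-indicator c)

IsInteger : ℚ → Set
IsInteger q = Σ ℤ λ z → q ≡ z / 1

/1-homo-+ : ∀ z w → z / 1 + w / 1 ≡ (z +ℤ w) / 1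
/1-homo-+ z w = ℚₚ.toℚᵘ-injective (begin
  toℚᵘ (z / 1 + w / 1)            ≈⟨ ℚₚ.toℚᵘ-homo-+ (z / 1) (w / 1) ⟩
  toℚᵘ (z / 1) ℚᵘ.+ toℚᵘ (w / 1)  ≈⟨ ℚᵘₚ.+-cong (ℚₚ.toℚᵘ-fromℚᵘ (ℚᵘ.mkℚᵘ z 0)) (ℚₚ.toℚᵘ-fromℚᵘ (ℚᵘ.mkℚᵘ w 0)) ⟩
  ℚᵘ.mkℚᵘ z 0 ℚᵘ.+ ℚᵘ.mkℚᵘ w 0    ≈⟨ ℚᵘ.*≡* (solve 2 (λ z w → (z :* con 1ℤ :+ w :* con 1ℤ) :* con 1ℤ
                                                           := (z :+ w) :* (con 1ℤ :* con 1ℤ)) refl z w) ⟩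
  ℚᵘ.mkℚᵘ (z +ℤ w) 0              ≈⟨ ℚᵘₚ.≃-sym (ℚₚ.toℚᵘ-fromℚᵘ (ℚᵘ.mkℚᵘ (z +ℤ w) 0)) ⟩
  toℚᵘ ((z +ℤ w) / 1)             ∎)
  where
  open ℚᵘₚ.≃-Reasoning
  open ℤ-Solver

/1-homo-neg : ∀ z → - (z / 1) ≡ (-ℤ z) / 1
/1-homo-neg z = ℚₚ.toℚᵘ-injective (begin
  toℚᵘ (- (z / 1))     ≈⟨ ℚₚ.toℚᵘ-homo‿- (z / 1) ⟩
  ℚᵘ.- toℚᵘ (z / 1)    ≈⟨ ℚᵘₚ.-‿cong (ℚₚ.toℚᵘ-fromℚᵘ (ℚᵘ.mkℚᵘ z 0)) ⟩
  ℚᵘ.mkℚᵘ (-ℤ z) 0     ≈⟨ ℚᵘₚ.≃-sym (ℚₚ.toℚᵘ-fromℚᵘ (ℚᵘ.mkℚᵘ (-ℤ z) 0)) ⟩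
  toℚᵘ ((-ℤ z) / 1)    ∎)
  where open ℚᵘₚ.≃-Reasoning

IsInteger-+ : ∀ {a b} → IsInteger a → IsInteger b → IsInteger (a + b)
IsInteger-+ (z , refl) (w , refl) = z +ℤ w , /1-homo-+ z w

IsInteger-neg : ∀ {a} → IsInteger a → IsInteger (- a)
IsInteger-neg (z , refl) = -ℤ z , /1-homo-neg z

IsInteger-∑ : ∀ q {g : Fin q → ℚ} → (∀ k → IsInteger (g k)) → IsInteger (∑[ k < q ] g k)
IsInteger-∑ zero    _   = 0ℤ , refl
IsInteger-∑ (suc q) g∈ℤ = IsInteger-+ (g∈ℤ zero) (IsInteger-∑ q (g∈ℤ ∘ suc))

module _ {A : Set} where

  weightedSum : List (ℚ × A) → (A → ℚ) → ℚ
  weightedSum L h = sumℚ (map (λ ca → proj₁ ca * h (proj₂ ca)) L)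

  weightedSum-const : ∀ L c → weightedSum L (λ _ → c) ≡ coeffSum L * c
  weightedSum-const []            c = sym (ℚₚ.*-zeroˡ c)
  weightedSum-const ((a , _) ∷ L) c =
    trans (cong (a * c +_) (weightedSum-const L c)) (sym (ℚₚ.*-distribʳ-+ c a (coeffSum L)))

  weightedSum-+ : ∀ L h h' → weightedSum L (λ a → h a + h' a) ≡ weightedSum L h + weightedSum L h'
  weightedSum-+ []            h h' = refl
  weightedSum-+ ((c , a) ∷ L) h h' =
    trans (cong (c * (h a + h' a) +_) (weightedSum-+ L h h'))
          (regroup c (h a) (h' a) (weightedSum L h) (weightedSum L h'))
    where
    open ℚ-Solver
    regroup : ∀ c x y W W' → c * (x + y) + (W + W') ≡ (c * x + W) + (c * y + W')
    regroup = solve 5 (λ c x y W W' → c :* (x :+ y) :+ (W :+ W') := (c :* x :+ W) :+ (c :* y :+ W')) refl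

  weightedSum-neg : ∀ L h → weightedSum L (λ a → - h a) ≡ - weightedSum L h
  weightedSum-neg []            h = refl
  weightedSum-neg ((c , a) ∷ L) h =
    trans (cong (c * - h a +_) (weightedSum-neg L h)) (regroup c (h a) (weightedSum L h))
    where
    open ℚ-Solver
    regroup : ∀ c x W → c * - x + - W ≡ - (c * x + W)
    regroup = solve 3 (λ c x W → c :* (:- x) :+ (:- W) := :- (c :* x :+ W)) refl

  weightedSum-∑ : ∀ L q (h : Fin q → A → ℚ) →
    weightedSum L (λ a → ∑[ k < q ] h k a) ≡ ∑[ k < q ] weightedSum L (h k)
  weightedSum-∑ L zero    h = trans (weightedSum-const L 0ℚ) (ℚₚ.*-zeroʳ (coeffSum L))
  weightedSum-∑ L (suc q) h =
    trans (weightedSum-+ L (h zero) _) (cong (weightedSum L (h zero) +_) (weightedSum-∑ L q (h ∘ suc)))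

  weightedSum-cong-local : ∀ {R : A → Set} {L h h'} → All (R ∘ proj₂) L → (∀ {a} → R a → h a ≡ h' a) →
    weightedSum L h ≡ weightedSum L h'
  weightedSum-cong-local L∈R h≗h' =
    cong sumℚ (Listₚ.map-cong-local (All.map (λ {ca} r → cong (proj₁ ca *_) (h≗h' r)) L∈R))

module _ {A B : Set} (g : A → B) where

  relabelled : List (ℚ × A) → List (ℚ × B)
  relabelled = map (λ ca → proj₁ ca , g (proj₂ ca))

  coeffSum-relabelled : ∀ L → coeffSum (relabelled L) ≡ coeffSum L
  coeffSum-relabelled L = cong sumℚ (sym (Listₚ.map-∘ L))

  weightedSum-relabelled : ∀ L h → weightedSum (relabelled L) h ≡ weightedSum L (h ∘ g)
  weightedSum-relabelled L h = cong sumℚ (sym (Listₚ.map-∘ L))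

-- Kept as syntax so that affinity, extensionality and integrality of the maps
-- they define are proved once, by induction on the form.
data AffineForm (X : Set) : Set where
  const : ℤ → AffineForm X
  var   : X → AffineForm X
  _⊕_   : AffineForm X → AffineForm X → AffineForm X
  ⊝_    : AffineForm X → AffineForm X
  sumᶠ  : ∀ q → (Fin q → AffineForm X) → AffineForm X

infix  8 ⊝_
infixl 6 _⊕_ _⊖_

_⊖_ : {X : Set} → AffineForm X → AffineForm X → AffineForm X
F ⊖ G = F ⊕ ⊝ G

module _ {X : Set} where

  ⟦_⟧ : AffineForm X → (X → ℚ) → ℚ
  ⟦ const z ⟧  x = z / 1
  ⟦ var i ⟧    x = x i
  ⟦ F ⊕ G ⟧    x = ⟦ F ⟧ x + ⟦ G ⟧ x
  ⟦ ⊝ F ⟧      x = - ⟦ F ⟧ x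
  ⟦ sumᶠ q F ⟧ x = ∑[ k < q ] ⟦ F k ⟧ x

  ⟦⟧-affine : ∀ F L → coeffSum L ≡ 1ℚ → ⟦ F ⟧ (combV L) ≡ weightedSum L ⟦ F ⟧
  ⟦⟧-affine (const z) L ΣL≡1 =
    sym (trans (weightedSum-const L (z / 1)) (trans (cong (_* (z / 1)) ΣL≡1) (ℚₚ.*-identityˡ (z / 1))))
  ⟦⟧-affine (var i) L ΣL≡1 = refl
  ⟦⟧-affine (F ⊕ G) L ΣL≡1 =
    trans (cong₂ _+_ (⟦⟧-affine F L ΣL≡1) (⟦⟧-affine G L ΣL≡1)) (sym (weightedSum-+ L ⟦ F ⟧ ⟦ G ⟧))
  ⟦⟧-affine (⊝ F) L ΣL≡1 = trans (cong -_ (⟦⟧-affine F L ΣL≡1)) (sym (weightedSum-neg L ⟦ F ⟧))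
  ⟦⟧-affine (sumᶠ q F) L ΣL≡1 =
    trans (sum-cong-≗ (λ k → ⟦⟧-affine (F k) L ΣL≡1)) (sym (weightedSum-∑ L q (⟦_⟧ ∘ F)))

  ⟦⟧-cong : ∀ F {x y} → x ≗ y → ⟦ F ⟧ x ≡ ⟦ F ⟧ y
  ⟦⟧-cong (const z)  x≗y = refl
  ⟦⟧-cong (var i)    x≗y = x≗y i
  ⟦⟧-cong (F ⊕ G)    x≗y = cong₂ _+_ (⟦⟧-cong F x≗y) (⟦⟧-cong G x≗y)
  ⟦⟧-cong (⊝ F)      x≗y = cong -_ (⟦⟧-cong F x≗y)
  ⟦⟧-cong (sumᶠ q F) x≗y = sum-cong-≗ (λ k → ⟦⟧-cong (F k) x≗y)

  ⟦⟧-integral : ∀ F {x} → Integral x → IsInteger (⟦ F ⟧ x)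
  ⟦⟧-integral (const z)  x∈ℤ = z , refl
  ⟦⟧-integral (var i)    x∈ℤ = x∈ℤ i
  ⟦⟧-integral (F ⊕ G)    x∈ℤ = IsInteger-+ (⟦⟧-integral F x∈ℤ) (⟦⟧-integral G x∈ℤ)
  ⟦⟧-integral (⊝ F)      x∈ℤ = IsInteger-neg (⟦⟧-integral F x∈ℤ)
  ⟦⟧-integral (sumᶠ q F) x∈ℤ = IsInteger-∑ q (λ k → ⟦⟧-integral (F k) x∈ℤ)

record IsLatticeAffine {X Y : Set} (f : (X → ℚ) → Y → ℚ) : Set where
  field
    affine      : IsAffine f
    extensional : Extensional f
    integral    : ∀ x → Integral x → Integral (f x)
open IsLatticeAffine

formMap : {X Y : Set} → (Y → AffineForm X) → (X → ℚ) → Y → ℚ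
formMap F x j = ⟦ F j ⟧ x

formMap-isLatticeAffine : {X Y : Set} (F : Y → AffineForm X) → IsLatticeAffine (formMap F)
formMap-isLatticeAffine F = record
  { affine      = λ L ΣL≡1 j →
      trans (⟦⟧-affine (F j) L ΣL≡1) (sym (weightedSum-relabelled (formMap F) L (λ y → y j)))
  ; extensional = λ x y x≗y j → ⟦⟧-cong (F j) x≗y
  ; integral    = λ x x∈ℤ j → ⟦⟧-integral (F j) x∈ℤ
  }

IsAffine-∘ : {X Y Z : Set} {f : (X → ℚ) → Y → ℚ} {g : (Y → ℚ) → Z → ℚ} →
  IsAffine f → IsAffine g → Extensional g → IsAffine (g ∘ f)
IsAffine-∘ {f = f} {g} f-affine g-affine g-ext L ΣL≡1 j = begin
  g (f (combV L)) j                       ≡⟨ g-ext _ _ (f-affine L ΣL≡1) j ⟩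
  g (combV (relabelled f L)) j            ≡⟨ g-affine (relabelled f L) (trans (coeffSum-relabelled f L) ΣL≡1) j ⟩
  combV (relabelled g (relabelled f L)) j ≡⟨ cong (λ L → combV L j) (Listₚ.map-∘ L) ⟨
  combV (relabelled (g ∘ f) L) j          ∎
  where open ≡-Reasoning

-- InAff S and InConv S unfold to Hull P for P (c , B) = S B and P (c , B) = 0 ≤ c × S B.
Hull : {X : Set} → (ℚ × (X → Bool) → Set) → (X → ℚ) → Set
Hull {X} P x = Σ (List (ℚ × (X → Bool))) λ L → All P L × (coeffSum L ≡ 1ℚ) × (∀ i → x i ≡ combχ L i)

InConv⇒InAff : {X : Set} {S : (X → Bool) → Set} {x : X → ℚ} → InConv S x → InAff S x
InConv⇒InAff (L , L∈S , ΣL≡1 , x≗) = L , All.map proj₂ L∈S , ΣL≡1 , x≗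

χ-cong : {X : Set} {B B' : X → Bool} → B ≗ B' → χ B ≗ χ B'
χ-cong B≗B' i = cong (λ b → if b then 1ℚ else 0ℚ) (B≗B' i)

combχ-weightedSum : {X : Set} (L : List (ℚ × (X → Bool))) (i : X) → combχ L i ≡ weightedSum L (λ B → χ B i)
combχ-weightedSum L i = weightedSum-relabelled χ L (λ y → y i)

module _ {X Y : Set} {f : (X → ℚ) → Y → ℚ} (f-affine : IsAffine f) (f-ext : Extensional f) where

  apply-combχ : ∀ {x} L → coeffSum L ≡ 1ℚ → (∀ i → x i ≡ combχ L i) →
    ∀ j → f x j ≡ weightedSum L (λ B → f (χ B) j)
  apply-combχ {x} L ΣL≡1 x≗ j = begin
    f x j                            ≡⟨ f-ext x (combV Lχ) x≗ j ⟩
    f (combV Lχ) j                   ≡⟨ f-affine Lχ (trans (coeffSum-relabelled χ L) ΣL≡1) j ⟩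
    combV (relabelled f Lχ) j        ≡⟨ weightedSum-relabelled f Lχ (λ y → y j) ⟩
    weightedSum Lχ (λ v → f v j)     ≡⟨ weightedSum-relabelled χ L (λ v → f v j) ⟩
    weightedSum L (λ B → f (χ B) j)  ∎
    where
    open ≡-Reasoning
    Lχ = relabelled χ L

  module _ {P : ℚ × (X → Bool) → Set} {Q : ℚ × (Y → Bool) → Set}
           (vertex : ∀ {c B} → P (c , B) → Σ (Y → Bool) λ B' → Q (c , B') × (f (χ B) ≗ χ B')) where

    relabel : ∀ {L} → All P L → Σ (List (ℚ × (Y → Bool))) λ L' → All Q L' ×
      (coeffSum L' ≡ coeffSum L) × (∀ j → weightedSum L (λ B → f (χ B) j) ≡ combχ L' j)
    relabel [] = [] , [] , refl , λ j → refl
    relabel {(c , B) ∷ L} (pB ∷ L∈P) with vertex pB | relabel L∈P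
    ... | B' , qB' , fB≗B' | L' , L'∈Q , ΣL'≡ΣL , L'≗ =
      (c , B') ∷ L' , qB' ∷ L'∈Q , cong (c +_) ΣL'≡ΣL , λ j → cong₂ (λ a b → c * a + b) (fB≗B' j) (L'≗ j)

    hull-image : ∀ {x} → Hull P x → Hull Q (f x)
    hull-image (L , L∈P , ΣL≡1 , x≗) with relabel L∈P
    ... | L' , L'∈Q , ΣL'≡ΣL , L'≗ =
      L' , L'∈Q , trans ΣL'≡ΣL ΣL≡1 , λ j → trans (apply-combχ L ΣL≡1 x≗ j) (L'≗ j)

retraction : {X Y : Set} {S : (X → Bool) → Set} {f : (X → ℚ) → Y → ℚ} {g : (Y → ℚ) → X → ℚ} →
  IsLatticeAffine f → IsLatticeAffine g → (∀ {B} → S B → g (f (χ B)) ≗ χ B) →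
  ∀ {x} → InAff S x → g (f x) ≗ x
retraction {f = f} {g} F G g∘f≗id {x} (L , L∈S , ΣL≡1 , x≗) i = begin
  g (f x) i                           ≡⟨ apply-combχ (IsAffine-∘ (affine F) (affine G) (extensional G))
                                           (λ x y x≗y → extensional G _ _ (extensional F x y x≗y)) L ΣL≡1 x≗ i ⟩
  weightedSum L (λ B → g (f (χ B)) i) ≡⟨ weightedSum-cong-local L∈S (λ sB → g∘f≗id sB i) ⟩
  weightedSum L (λ B → χ B i)         ≡⟨ combχ-weightedSum L i ⟨
  combχ L i                           ≡⟨ x≗ i ⟨
  x i                                 ∎
  where open ≡-Reasoning

record Parametrisation {X : Set} (C : Set) (S : (X → Bool) → Set) : Set where
  field
    point   : C → X → Bool
    point-∈ : ∀ c → S (point c)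
    onto    : ∀ {B} → S B → Σ C λ c → B ≗ point c
open Parametrisation

module _ {X Y C : Set} {S : (X → Bool) → Set} {T : (Y → Bool) → Set}
         (β : Parametrisation C S) (σ : Parametrisation C T)
         {f : (X → ℚ) → Y → ℚ} (f-ext : Extensional f)
         (f-vertex : ∀ c → f (χ (point β c)) ≗ χ (point σ c)) where

  vertex-image : ∀ {B} → S B → Σ (Y → Bool) λ B' → T B' × (f (χ B) ≗ χ B')
  vertex-image sB with onto β sB
  ... | c , B≗ = point σ c , point-∈ σ c , λ j → trans (f-ext _ _ (χ-cong B≗) j) (f-vertex c j)

  vertex-retraction : {g : (Y → ℚ) → X → ℚ} → Extensional g → (∀ c → g (χ (point σ c)) ≗ χ (point β c)) →
    ∀ {B} → S B → g (f (χ B)) ≗ χ B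
  vertex-retraction g-ext g-vertex sB i with onto β sB
  ... | c , B≗ = trans (g-ext _ _ (λ j → trans (f-ext _ _ (χ-cong B≗) j) (f-vertex c j)) i)
                       (trans (g-vertex c i) (sym (χ-cong B≗ i)))

keep-weight : {X Y : Set} {S : (X → Bool) → Set} {T : (Y → Bool) → Set} {R : (X → Bool) → (Y → Bool) → Set} →
  (∀ {B} → S B → Σ (Y → Bool) λ B' → T B' × R B B') →
  ∀ {c B} → (0ℚ ≤ℚ c) × S B → Σ (Y → Bool) λ B' → ((0ℚ ≤ℚ c) × T B') × R B B'
keep-weight vertex (0≤c , sB) with vertex sB
... | B' , tB' , rel = B' , (0≤c , tB') , rel

unimodEquiv-byVertices : {X Y C : Set} {S : (X → Bool) → Set} {T : (Y → Bool) → Set}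
  {f : (X → ℚ) → Y → ℚ} {g : (Y → ℚ) → X → ℚ} → IsLatticeAffine f → IsLatticeAffine g →
  (β : Parametrisation C S) (σ : Parametrisation C T) →
  (∀ c → f (χ (point β c)) ≗ χ (point σ c)) → (∀ c → g (χ (point σ c)) ≗ χ (point β c)) →
  UnimodEquiv S T
unimodEquiv-byVertices {X} {Y} {S = S} {T} {f} {g} F G β σ f-vertex g-vertex =
  f , affine F , extensional F , aff-image , injective , aff-onto , integrality , conv-image , conv-onto
  where
  to : ∀ {B} → S B → Σ (Y → Bool) λ B' → T B' × (f (χ B) ≗ χ B')
  to = vertex-image β σ (extensional F) f-vertex

  from : ∀ {B} → T B → Σ (X → Bool) λ B' → S B' × (g (χ B) ≗ χ B')
  from = vertex-image σ β (extensional G) g-vertex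

  g∘f≗id : ∀ {x} → InAff S x → g (f x) ≗ x
  g∘f≗id = retraction F G (vertex-retraction β σ (extensional F) f-vertex (extensional G) g-vertex)

  f∘g≗id : ∀ {y} → InAff T y → f (g y) ≗ y
  f∘g≗id = retraction G F (vertex-retraction σ β (extensional G) g-vertex (extensional F) f-vertex)

  aff-image : ∀ x → InAff S x → InAff T (f x)
  aff-image _ = hull-image (affine F) (extensional F) to

  injective : ∀ x y → InAff S x → InAff S y → (∀ j → f x j ≡ f y j) → ∀ i → x i ≡ y i
  injective x y x∈ y∈ fx≗fy i = trans (sym (g∘f≗id x∈ i)) (trans (extensional G _ _ fx≗fy i) (g∘f≗id y∈ i))

  aff-onto : ∀ y → InAff T y → Σ (X → ℚ) λ x → InAff S x × (∀ j → f x j ≡ y j)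
  aff-onto y y∈ = g y , hull-image (affine G) (extensional G) from y∈ , f∘g≗id y∈

  integrality : ∀ x → InAff S x → (Integral x → Integral (f x)) × (Integral (f x) → Integral x)
  integrality x x∈ = integral F x , λ fx∈ℤ i → subst IsInteger (g∘f≗id x∈ i) (integral G (f x) fx∈ℤ i)

  conv-image : ∀ x → InConv S x → InConv T (f x)
  conv-image _ = hull-image (affine F) (extensional F) (keep-weight {S = S} {T} to)

  conv-onto : ∀ y → InConv T y → Σ (X → ℚ) λ x → InConv S x × (∀ j → f x j ≡ y j)
  conv-onto y y∈ =
    g y , hull-image (affine G) (extensional G) (keep-weight {S = T} {S} from) y∈ , f∘g≗id (InConv⇒InAff y∈)

module _ (G : Multigraph) where

  end₁ end₂ : E G → V G
  end₁ e = proj₁ (ends G e)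
  end₂ e = proj₂ (ends G e)

  module _ {P : E G → Set} where

    ConnP-trans : ∀ {a b c} → ConnP G P a b → ConnP G P b c → ConnP G P a c
    ConnP-trans here         bc = bc
    ConnP-trans (fwd e pe r) bc = fwd e pe (ConnP-trans r bc)
    ConnP-trans (bwd e pe r) bc = bwd e pe (ConnP-trans r bc)

    ConnP-sym : ∀ {a b} → ConnP G P a b → ConnP G P b a
    ConnP-sym here         = here
    ConnP-sym (fwd e pe r) = ConnP-trans (ConnP-sym r) (bwd e pe here)
    ConnP-sym (bwd e pe r) = ConnP-trans (ConnP-sym r) (fwd e pe here)

    ConnP-invariant : {A : Set} (σ : V G → A) → (∀ e → P e → σ (end₁ e) ≡ σ (end₂ e)) →
      ∀ {a b} → ConnP G P a b → σ a ≡ σ b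
    ConnP-invariant σ kept here         = refl
    ConnP-invariant σ kept (fwd e pe r) = trans (kept e pe) (ConnP-invariant σ kept r)
    ConnP-invariant σ kept (bwd e pe r) = trans (sym (kept e pe)) (ConnP-invariant σ kept r)

  module _ (P : E G → Set) where

    Link : ∀ {q} → (Fin (suc q) → V G) → Fin q → Set
    Link w i = ConnP G P (w (inject₁ i)) (w (suc i))

    walk : ∀ {q} (w : Fin (suc q) → V G) → (∀ i → Link w i) → ConnP G P (w zero) (w (fromℕ q))
    walk {zero}  w links = here
    walk {suc q} w links = ConnP-trans (links zero) (walk (w ∘ suc) (links ∘ suc))

    walk-to : ∀ {q} (w : Fin (suc q) → V G) o → (∀ i → i ≢ o → Link w i) → ConnP G P (w zero) (w (inject₁ o))
    walk-to w zero    links = here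
    walk-to w (suc o) links =
      ConnP-trans (links zero λ ()) (walk-to (w ∘ suc) o λ i i≢o → links (suc i) (i≢o ∘ Finₚ.suc-injective))

    walk-from : ∀ {q} (w : Fin (suc q) → V G) o → (∀ i → i ≢ o → Link w i) → ConnP G P (w (suc o)) (w (fromℕ q))
    walk-from w zero    links = walk (w ∘ suc) λ i → links (suc i) λ ()
    walk-from w (suc o) links = walk-from (w ∘ suc) o λ i i≢o → links (suc i) (i≢o ∘ Finₚ.suc-injective)

    -- Two walks with common ends form a cycle: a link missing from one is bridged by going around.
    around : ∀ {q q'} (w : Fin (suc q) → V G) (w' : Fin (suc q') → V G) →
      w zero ≡ w' zero → w (fromℕ q) ≡ w' (fromℕ q') → (∀ i → Link w' i) →
      ∀ o → (∀ i → i ≢ o → Link w i) → Link w o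
    around w w' same-start same-end links' o links =
      ConnP-trans (ConnP-sym (walk-to w o links))
        (ConnP-trans (subst₂ (ConnP G P) (sym same-start) (sym same-end) (walk w' links'))
          (ConnP-sym (walk-from w o links)))

<ᵇ-irrefl : ∀ a → (a <ᵇ a) ≡ false
<ᵇ-irrefl zero    = refl
<ᵇ-irrefl (suc a) = <ᵇ-irrefl a

<ᵇ-suc : ∀ a → (a <ᵇ suc a) ≡ true
<ᵇ-suc zero    = refl
<ᵇ-suc (suc a) = <ᵇ-suc a

<ᵇ-step : ∀ {a q} → a ≢ q → (a <ᵇ q) ≡ (a <ᵇ suc q)
<ᵇ-step {zero}  {zero}  a≢q = ⊥-elim (a≢q refl)
<ᵇ-step {zero}  {suc q} a≢q = refl
<ᵇ-step {suc a} {zero}  a≢q = refl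
<ᵇ-step {suc a} {suc q} a≢q = <ᵇ-step (a≢q ∘ cong suc)

<⇒<ᵇ≡true : ∀ {a q} → a < q → (a <ᵇ q) ≡ true
<⇒<ᵇ≡true a<q = Equivalence.to Boolₚ.T-≡ (ℕₚ.<⇒<ᵇ a<q)

-- Step M q r r' : on a cycle with positions and ranks 0 … M, the edge at
-- position q joins the vertices of ranks r and r' (position M closes the cycle).
data Step (M q r r' : ℕ) : Set where
  inner : r ≡ q → r' ≡ suc q → Step M q r r'
  wrap  : q ≡ M → r ≡ M → r' ≡ 0 → Step M q r r'

module CycleCut (G : Multigraph) (M : ℕ) (rank : V G → ℕ) (pos : E G → ℕ) (pos≤M : ∀ e → pos e ≤ M)
  (step : ∀ e → Step M (pos e) (rank (end₁ G e)) (rank (end₂ G e)) ⊎ Step M (pos e) (rank (end₂ G e)) (rank (end₁ G e)))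
  where

  -- Removing positions a and b cuts the cycle into two arcs; side a b tells them apart.
  side : ℕ → ℕ → ℕ → Bool
  side a b r = (a <ᵇ r) xor (b <ᵇ r)

  side-kept : ∀ {a b q r r'} → a ≤ M → b ≤ M → q ≢ a → q ≢ b → Step M q r r' → side a b r ≡ side a b r'
  side-kept _   _   q≢a q≢b (inner refl refl) = cong₂ _xor_ (<ᵇ-step (q≢a ∘ sym)) (<ᵇ-step (q≢b ∘ sym))
  side-kept a≤M b≤M q≢a q≢b (wrap refl refl refl) =
    cong₂ _xor_ (<⇒<ᵇ≡true (ℕₚ.≤∧≢⇒< a≤M (q≢a ∘ sym))) (<⇒<ᵇ≡true (ℕₚ.≤∧≢⇒< b≤M (q≢b ∘ sym)))

  side-flipped : ∀ {a b r r'} → b ≤ M → a ≢ b → Step M a r r' → side a b r ≢ side a b r'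
  side-flipped {a} {b} _ a≢b (inner refl refl) same = Boolₚ.not-¬ (<ᵇ-step (a≢b ∘ sym)) (begin
    b <ᵇ a                 ≡⟨ cong (_xor (b <ᵇ a)) (<ᵇ-irrefl a) ⟨
    side a b a             ≡⟨ same ⟩
    side a b (suc a)       ≡⟨ cong (_xor (b <ᵇ suc a)) (<ᵇ-suc a) ⟩
    not (b <ᵇ suc a)       ∎)
    where open ≡-Reasoning
  side-flipped b≤M a≢b (wrap refl refl refl) same with
    trans (sym (cong₂ _xor_ (<ᵇ-irrefl M) (<⇒<ᵇ≡true (ℕₚ.≤∧≢⇒< b≤M (a≢b ∘ sym))))) same
  ... | ()

  cut : ∀ {P} e b → b ≤ M → pos e ≢ b → (∀ e' → P e' → pos e' ≢ pos e × pos e' ≢ b) →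
    ¬ ConnP G P (end₁ G e) (end₂ G e)
  cut {P} e b b≤M e≢b avoids conn = flipped (step e)
    where
    σ : V G → Bool
    σ w = side (pos e) b (rank w)

    kept : ∀ e' → P e' → σ (end₁ G e') ≡ σ (end₂ G e')
    kept e' pe' with step e'
    ... | inj₁ st = side-kept (pos≤M e) b≤M (proj₁ (avoids e' pe')) (proj₂ (avoids e' pe')) st
    ... | inj₂ st = sym (side-kept (pos≤M e) b≤M (proj₁ (avoids e' pe')) (proj₂ (avoids e' pe')) st)

    same : σ (end₁ G e) ≡ σ (end₂ G e)
    same = ConnP-invariant G σ kept conn

    flipped : Step M (pos e) (rank (end₁ G e)) (rank (end₂ G e)) ⊎ Step M (pos e) (rank (end₂ G e)) (rank (end₁ G e)) → ⊥
    flipped (inj₁ st) = side-flipped b≤M e≢b st same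
    flipped (inj₂ st) = side-flipped b≤M e≢b st (sym same)

does-true : {A : Set} (a? : Dec A) → does a? ≡ true → A
does-true (yes a) _ = a
does-true (no _) ()

not-does : {A : Set} (a? : Dec A) → not (does a?) ≡ true → ¬ A
not-does (yes _) ()
not-does (no ¬a) _ = ¬a

not-does∧does : {A B : Set} (a? : Dec A) (b? : Dec B) → not (does a?) ∧ does b? ≡ true → ¬ A × B
not-does∧does (yes _) _       ()
not-does∧does (no _)  (no _)  ()
not-does∧does (no ¬a) (yes b) _ = ¬a , b

atMostOne⇒indicator : ∀ {q} (b : Fin q → Bool) → (∀ {i j} → b i ≡ true → b j ≡ true → i ≡ j) →
  Σ (Fin (suc q)) λ c → ∀ i → b i ≡ does (c ≟ suc i)
atMostOne⇒indicator b unique with Finₚ.any? (λ i → b i Boolₚ.≟ true)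
... | yes (i , bi) = suc i , indicates
  where
  indicates : ∀ j → b j ≡ does (i ≟ j)
  indicates j with i ≟ j
  ... | yes refl = bi
  ... | no i≢j   = Boolₚ.¬-not (λ bj → i≢j (unique bi bj))
... | no none = zero , λ j → Boolₚ.¬-not (λ bj → none (j , bj))

pick-fromℕ : ∀ {A : Set} q (f : Fin q → A) a → pick q f a (fromℕ q) ≡ a
pick-fromℕ zero    f a = refl
pick-fromℕ (suc q) f a = pick-fromℕ q (f ∘ suc) a

pick-inject₁ : ∀ {A : Set} q (f : Fin q → A) a k → pick q f a (inject₁ k) ≡ f k
pick-inject₁ (suc q) f a zero    = refl
pick-inject₁ (suc q) f a (suc k) = pick-inject₁ q (f ∘ suc) a k

module _ (n : ℕ) (s : Fin n → ℕ) (p : ℕ) where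

  private
    G : Multigraph
    G = 𝓑 n s p

  data Class : Set where
    parᶜ  : Fin n → Class
    pathᶜ : Fin (suc p) → Class

  class : BEdge n s p → Class
  class (par i _) = parᶜ i
  class (path k)  = pathᶜ k

  parᶜ-injective : ∀ {i j} → parᶜ i ≡ parᶜ j → i ≡ j
  parᶜ-injective refl = refl

  pathᶜ-injective : ∀ {k l} → pathᶜ k ≡ pathᶜ l → k ≡ l
  pathᶜ-injective refl = refl

  _≟ᶜ_ : (c c' : Class) → Dec (c ≡ c')
  parᶜ i  ≟ᶜ parᶜ j  = map′ (cong parᶜ) parᶜ-injective (i ≟ j)
  pathᶜ k ≟ᶜ pathᶜ l = map′ (cong pathᶜ) pathᶜ-injective (k ≟ l)
  parᶜ _  ≟ᶜ pathᶜ _ = no λ ()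
  pathᶜ _ ≟ᶜ parᶜ _  = no λ ()

  Choice : Set
  Choice = (i : Fin n) → Fin (suc (s i))

  -- A code (o , ch) stands for the spanning tree omitting the class o and using edge
  -- ch i of every other bundle i, and for the stable set containing m i if o = parᶜ i,
  -- gu k if o = pathᶜ (suc k), and vv i j iff ch i = suc j and o ≠ parᶜ i.
  Code : Set
  Code = Class × Choice

  basisOf : Code → BEdge n s p → Bool
  basisOf (o , ch) (par i k) = not (does (o ≟ᶜ parᶜ i)) ∧ does (ch i ≟ k)
  basisOf (o , ch) (path k)  = not (does (o ≟ᶜ pathᶜ k))

  stableOf : Code → GVert n s p → Bool
  stableOf (o , ch) (m i)    = does (o ≟ᶜ parᶜ i)
  stableOf (o , ch) (gu k)   = does (o ≟ᶜ pathᶜ (suc k))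
  stableOf (o , ch) (vv i j) = not (does (o ≟ᶜ parᶜ i)) ∧ does (ch i ≟ suc j)

  Occupied : (BEdge n s p → Set) → Class → Set
  Occupied P c = Σ (BEdge n s p) λ e → class e ≡ c × P e

  Connects : (BEdge n s p → Set) → Class → Set
  Connects P (parᶜ i)  = Link G P v i
  Connects P (pathᶜ k) = Link G P (pathVert n p) k

  connects-ends : ∀ {P} e → Connects P (class e) → ConnP G P (end₁ G e) (end₂ G e)
  connects-ends (par i k) conn = conn
  connects-ends (path k)  conn = conn

  occupied-connects : ∀ {P c} → Occupied P c → Connects P c
  occupied-connects (par i k , refl , pe) = fwd (par i k) pe here
  occupied-connects (path k  , refl , pe) = fwd (path k) pe here

  connects-omitted : ∀ {P} o → (∀ c → c ≢ o → Occupied P c) → Connects P o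
  connects-omitted {P} (parᶜ i) occupied =
    around G P v (pathVert n p) refl (sym (pick-fromℕ p u (v (fromℕ n))))
      (λ k → occupied-connects (occupied (pathᶜ k) λ ()))
      i (λ j j≢i → occupied-connects (occupied (parᶜ j) (j≢i ∘ parᶜ-injective)))
  connects-omitted {P} (pathᶜ k) occupied =
    around G P (pathVert n p) v refl (pick-fromℕ p u (v (fromℕ n)))
      (λ i → occupied-connects (occupied (parᶜ i) λ ()))
      k (λ l l≢k → occupied-connects (occupied (pathᶜ l) (l≢k ∘ pathᶜ-injective)))

  -- Going around the cycle v_1 … v_{n+1} u_p … u_1 v_1: bundle i sits at position i,
  -- path edge k at position M - k, and the vertices are ranked accordingly.
  M : ℕ
  M = n +ℕ p

  rank : BVert n p → ℕ
  rank (v i) = toℕ i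
  rank (u k) = M ∸ toℕ k

  posᶜ : Class → ℕ
  posᶜ (parᶜ i)  = toℕ i
  posᶜ (pathᶜ k) = M ∸ toℕ k

  posᶜ≤M : ∀ c → posᶜ c ≤ M
  posᶜ≤M (parᶜ i)  = ℕₚ.≤-trans (ℕₚ.<⇒≤ (Finₚ.toℕ<n i)) (ℕₚ.m≤m+n n p)
  posᶜ≤M (pathᶜ k) = ℕₚ.m∸n≤m M (toℕ k)

  toℕ≤M : ∀ (k : Fin (suc p)) → toℕ k ≤ M
  toℕ≤M k = ℕₚ.≤-trans (Finₚ.toℕ≤pred[n] k) (ℕₚ.m≤n+m p n)

  posᶜ-injective : ∀ {c c'} → posᶜ c ≡ posᶜ c' → c ≡ c'
  posᶜ-injective {parᶜ i}  {parᶜ j}  eq = cong parᶜ (Finₚ.toℕ-injective eq)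
  posᶜ-injective {pathᶜ k} {pathᶜ l} eq = cong pathᶜ (Finₚ.toℕ-injective (ℕₚ.∸-cancelˡ-≡ (toℕ≤M k) (toℕ≤M l) eq))
  posᶜ-injective {parᶜ i}  {pathᶜ k} eq = ⊥-elim (ℕₚ.<⇒≱ (Finₚ.toℕ<n i) (begin
    n              ≡⟨ ℕₚ.m+n∸n≡m n p ⟨
    M ∸ p          ≤⟨ ℕₚ.∸-monoʳ-≤ M (Finₚ.toℕ≤pred[n] k) ⟩
    M ∸ toℕ k      ≡⟨ eq ⟨
    toℕ i          ∎))
    where open ℕₚ.≤-Reasoning
  posᶜ-injective {pathᶜ k} {parᶜ i}  eq = sym (posᶜ-injective (sym eq))

  rank-pathVert : ∀ j → rank (pathVert n p (suc j)) ≡ M ∸ toℕ j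
  rank-pathVert j with Top.view j
  ... | ‵fromℕ = begin
    rank (pick p u (v (fromℕ n)) (fromℕ p)) ≡⟨ cong rank (pick-fromℕ p u (v (fromℕ n))) ⟩
    toℕ (fromℕ n)                           ≡⟨ Finₚ.toℕ-fromℕ n ⟩
    n                                       ≡⟨ ℕₚ.m+n∸n≡m n p ⟨
    M ∸ p                                   ≡⟨ cong (M ∸_) (Finₚ.toℕ-fromℕ p) ⟨
    M ∸ toℕ (fromℕ p)                       ∎
    where open ≡-Reasoning
  ... | ‵inject₁ k = trans (cong rank (pick-inject₁ p u (v (fromℕ n)) k)) (cong (M ∸_) (sym (Finₚ.toℕ-inject₁ k)))

  step : ∀ e → Step M (posᶜ (class e)) (rank (end₁ G e)) (rank (end₂ G e))
             ⊎ Step M (posᶜ (class e)) (rank (end₂ G e)) (rank (end₁ G e))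
  step (par i k)      = inj₁ (inner (Finₚ.toℕ-inject₁ i) refl)
  step (path zero)    = inj₂ (wrap refl (rank-pathVert zero) refl)
  step (path (suc k)) = inj₂ (inner (rank-pathVert (suc k)) (begin
    rank (pathVert n p (suc (inject₁ k))) ≡⟨ rank-pathVert (inject₁ k) ⟩
    M ∸ toℕ (inject₁ k)                   ≡⟨ cong (M ∸_) (Finₚ.toℕ-inject₁ k) ⟩
    M ∸ toℕ k                             ≡⟨ ℕₚ.+-∸-assoc 1 (ℕₚ.≤-trans (Finₚ.toℕ<n k) (ℕₚ.m≤n+m p n)) ⟩
    suc (M ∸ suc (toℕ k))                 ∎))
    where open ≡-Reasoning

  open CycleCut G M rank (posᶜ ∘ class) (posᶜ≤M ∘ class) step using (cut)

  class-cut : ∀ {P} e c → class e ≢ c → (∀ e' → P e' → class e' ≢ class e × class e' ≢ c) →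
    ¬ ConnP G P (end₁ G e) (end₂ G e)
  class-cut e c e≢c avoids = cut e (posᶜ c) (posᶜ≤M c) (e≢c ∘ posᶜ-injective)
    (λ e' pe' → (proj₁ (avoids e' pe') ∘ posᶜ-injective) , (proj₂ (avoids e' pe') ∘ posᶜ-injective))

  occupied-path : ∀ {P k} → Occupied P (pathᶜ k) → P (path k)
  occupied-path (path _ , refl , pe) = pe

  representative : Class → BEdge n s p
  representative (parᶜ i)  = par i zero
  representative (pathᶜ k) = path k

  class-representative : ∀ c → class (representative c) ≡ c
  class-representative (parᶜ i)  = refl
  class-representative (pathᶜ k) = refl

  basisOf-par : ∀ {o ch i k} → basisOf (o , ch) (par i k) ≡ true → o ≢ parᶜ i × ch i ≡ k
  basisOf-par {o} {ch} {i} {k} = not-does∧does (o ≟ᶜ parᶜ i) (ch i ≟ k)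

  basisOf-avoids : ∀ {o ch} e → basisOf (o , ch) e ≡ true → class e ≢ o
  basisOf-avoids {o} {ch} (par i k) b = proj₁ (basisOf-par {o} {ch} b) ∘ sym
  basisOf-avoids {o} (path k) b = not-does (o ≟ᶜ pathᶜ k) b ∘ sym

  basisOf-unique : ∀ {o ch} e e' → basisOf (o , ch) e ≡ true → basisOf (o , ch) e' ≡ true → class e ≡ class e' → e ≡ e'
  basisOf-unique {o} {ch} (par i k) (par .i k') b b' refl =
    cong (par i) (trans (sym (proj₂ (basisOf-par {o} {ch} b))) (proj₂ (basisOf-par {o} {ch} b')))
  basisOf-unique (path k)  (path .k)   b b' refl = refl

  basisOf-occupies : ∀ {o ch} c → c ≢ o → Occupied (λ e → basisOf (o , ch) e ≡ true) c
  basisOf-occupies {o} {ch} (parᶜ i) c≢o =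
    par i (ch i) , refl , cong₂ _∧_ (cong not (dec-false (o ≟ᶜ parᶜ i) (c≢o ∘ sym))) (dec-true (ch i ≟ ch i) refl)
  basisOf-occupies {o} (pathᶜ k) c≢o = path k , refl , cong not (dec-false (o ≟ᶜ pathᶜ k) (c≢o ∘ sym))

  basisOf-forest : ∀ c → Forest G (basisOf c)
  basisOf-forest (o , ch) e b = class-cut e o (basisOf-avoids e b)
    λ e' (b' , e'≢e) → (e'≢e ∘ basisOf-unique e' e b' b) , basisOf-avoids e' b'

  basisOf-spanning : ∀ c e → ConnP G (λ e' → basisOf c e' ≡ true) (end₁ G e) (end₂ G e)
  basisOf-spanning (o , ch) e = connects-ends e (connects (class e))
    where
    connects : ∀ c → Connects (λ e' → basisOf (o , ch) e' ≡ true) c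
    connects c with c ≟ᶜ o
    ... | yes refl = connects-omitted c basisOf-occupies
    ... | no c≢o   = occupied-connects (basisOf-occupies c c≢o)

  module SpanningForestCode {B : BEdge n s p → Bool} (forest : Forest G B)
    (spanning : ∀ e → ConnP G (λ e' → B e' ≡ true) (end₁ G e) (end₂ G e)) where

    InB : BEdge n s p → Set
    InB e = B e ≡ true

    bundle-unique : ∀ {i k k'} → B (par i k) ≡ true → B (par i k') ≡ true → k ≡ k'
    bundle-unique {i} {k} {k'} b b' = decidable-stable (k ≟ k') λ k≢k' →
      forest (par i k) b (fwd (par i k') (b' , λ { refl → k≢k' refl }) here)

    occupied? : ∀ c → Dec (Occupied InB c)
    occupied? (parᶜ i)  = map′ (λ (k , b) → par i k , refl , b) bundleEdge (Finₚ.any? λ k → B (par i k) Boolₚ.≟ true)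
      where
      bundleEdge : Occupied InB (parᶜ i) → Σ (Fin (suc (s i))) λ k → B (par i k) ≡ true
      bundleEdge (par .i k , refl , b) = k , b
    occupied? (pathᶜ k) = map′ (λ b → path k , refl , b) occupied-path (B (path k) Boolₚ.≟ true)

    -- Otherwise path 0 closes a cycle with an edge from every other class.
    not-all-occupied : ¬ (∀ c → Occupied InB c)
    not-all-occupied occupied =
      forest (path zero) (occupied-path (occupied (pathᶜ zero))) (connects-omitted (pathᶜ zero) others)
      where
      others : ∀ c → c ≢ pathᶜ zero → Occupied (Without G B (path zero)) c
      others c c≢ with occupied c
      ... | e , refl , b = e , refl , b , λ { refl → c≢ refl }

    empty-class : Σ Class λ o → ¬ Occupied InB o
    empty-class with Finₚ.all? (occupied? ∘ parᶜ) | Finₚ.all? (occupied? ∘ pathᶜ)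
    ... | no ¬all | _ with Finₚ.¬∀⟶∃¬ n _ (occupied? ∘ parᶜ) ¬all
    ...   | i , ¬occ = parᶜ i , ¬occ
    empty-class | yes _ | no ¬all with Finₚ.¬∀⟶∃¬ (suc p) _ (occupied? ∘ pathᶜ) ¬all
    ...   | k , ¬occ = pathᶜ k , ¬occ
    empty-class | yes all-par | yes all-path =
      ⊥-elim (not-all-occupied λ { (parᶜ i) → all-par i ; (pathᶜ k) → all-path k })

    one-empty-class : ∀ {c c'} → c ≢ c' → ¬ Occupied InB c → ¬ Occupied InB c' → ⊥
    one-empty-class {c} {c'} c≢c' ¬occ ¬occ' =
      class-cut (representative c) c' (subst (_≢ c') (sym (class-representative c)) c≢c')
        (λ e b → (λ eq → ¬occ (e , trans eq (class-representative c) , b)) , (λ eq → ¬occ' (e , eq , b)))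
        (spanning (representative c))

    choice : ∀ i → Σ (Fin (suc (s i))) λ k → Occupied InB (parᶜ i) → B (par i k) ≡ true
    choice i with occupied? (parᶜ i)
    ... | yes (par .i k , refl , b) = k , λ _ → b
    ... | no ¬occ = zero , λ occ → ⊥-elim (¬occ occ)

    module _ (o : Class) (o-empty : ¬ Occupied InB o) where

      occupied-elsewhere : ∀ c → c ≢ o → Occupied InB c
      occupied-elsewhere c c≢o = decidable-stable (occupied? c) λ ¬occ → one-empty-class c≢o ¬occ o-empty

      B≗basisOf : B ≗ basisOf (o , proj₁ ∘ choice)
      B≗basisOf (par i k) with o ≟ᶜ parᶜ i | proj₁ (choice i) ≟ k
      ... | yes o≡ | _        = Boolₚ.¬-not λ b → o-empty (par i k , sym o≡ , b)
      ... | no o≢  | yes refl = proj₂ (choice i) (occupied-elsewhere (parᶜ i) (o≢ ∘ sym))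
      ... | no o≢  | no ch≢k  =
        Boolₚ.¬-not λ b → ch≢k (bundle-unique (proj₂ (choice i) (occupied-elsewhere (parᶜ i) (o≢ ∘ sym))) b)
      B≗basisOf (path k) with o ≟ᶜ pathᶜ k
      ... | yes o≡ = Boolₚ.¬-not λ b → o-empty (path k , sym o≡ , b)
      ... | no o≢  = occupied-path (occupied-elsewhere (pathᶜ k) (o≢ ∘ sym))

    code : Σ Code λ c → B ≗ basisOf c
    code with empty-class
    ... | o , o-empty = (o , proj₁ ∘ choice) , B≗basisOf o o-empty

  bases : Parametrisation Code (IsBasisM G)
  bases = record
    { point   = basisOf
    ; point-∈ = λ c → basisOf-forest c , basisOf-spanning c
    ; onto    = λ (forest , spanning) → SpanningForestCode.code forest spanning
    }

  stable-byCliques : ∀ {T : GVert n s p → Bool} →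
    (∀ {x y} → T x ≡ true → T y ≡ true → Core x → Core y → x ≡ y) →
    (∀ {i x y} → T x ≡ true → T y ≡ true → InBlock i x → InBlock i y → x ≡ y) →
    StableG n s p T
  stable-byCliques core block x y tx ty (x≢y , inj₁ (cx , cy))     = x≢y (core tx ty cx cy)
  stable-byCliques core block x y tx ty (x≢y , inj₂ (i , bx , by)) = x≢y (block tx ty bx by)

  stableOf-stable : ∀ c → StableG n s p (stableOf c)
  stableOf-stable (o , ch) = stable-byCliques core block
    where
    T : GVert n s p → Bool
    T = stableOf (o , ch)

    m∈T : ∀ {i} → T (m i) ≡ true → o ≡ parᶜ i
    m∈T {i} = does-true (o ≟ᶜ parᶜ i)

    gu∈T : ∀ {k} → T (gu k) ≡ true → o ≡ pathᶜ (suc k)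
    gu∈T {k} = does-true (o ≟ᶜ pathᶜ (suc k))

    vv∈T : ∀ {i j} → T (vv i j) ≡ true → o ≢ parᶜ i × ch i ≡ suc j
    vv∈T {i} {j} = not-does∧does (o ≟ᶜ parᶜ i) (ch i ≟ suc j)

    core : ∀ {x y} → T x ≡ true → T y ≡ true → Core x → Core y → x ≡ y
    core {m i}  {m j}  tx ty _ _ = cong m (parᶜ-injective (trans (sym (m∈T tx)) (m∈T ty)))
    core {m i}  {gu k} tx ty _ _ with trans (sym (m∈T tx)) (gu∈T ty)
    ... | ()
    core {gu k} {m i}  tx ty _ _ with trans (sym (m∈T ty)) (gu∈T tx)
    ... | ()
    core {gu k} {gu l} tx ty _ _ = cong gu (Finₚ.suc-injective (pathᶜ-injective (trans (sym (gu∈T tx)) (gu∈T ty))))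

    block : ∀ {i x y} → T x ≡ true → T y ≡ true → InBlock i x → InBlock i y → x ≡ y
    block tx ty (inj₁ refl)       (inj₁ refl)        = refl
    block tx ty (inj₁ refl)       (inj₂ (_ , refl))  = ⊥-elim (proj₁ (vv∈T ty) (m∈T tx))
    block tx ty (inj₂ (_ , refl)) (inj₁ refl)        = ⊥-elim (proj₁ (vv∈T tx) (m∈T ty))
    block tx ty (inj₂ (_ , refl)) (inj₂ (_ , refl))  =
      cong (vv _) (Finₚ.suc-injective (trans (sym (proj₂ (vv∈T tx))) (proj₂ (vv∈T ty))))

  module StableSetCode {T : GVert n s p → Bool} (stable : StableG n s p T) where

    together-equal : ∀ {x y} → T x ≡ true → T y ≡ true →
      (Core x × Core y) ⊎ (Σ (Fin n) λ i → InBlock i x × InBlock i y) → ¬ ¬ x ≡ y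
    together-equal tx ty together x≢y = stable _ _ tx ty (x≢y , together)

    m-unique : ∀ {i j} → T (m i) ≡ true → T (m j) ≡ true → i ≡ j
    m-unique {i} {j} ti tj = decidable-stable (i ≟ j) λ i≢j →
      together-equal ti tj (inj₁ (tt , tt)) λ { refl → i≢j refl }

    gu-unique : ∀ {k l} → T (gu k) ≡ true → T (gu l) ≡ true → k ≡ l
    gu-unique {k} {l} tk tl = decidable-stable (k ≟ l) λ k≢l →
      together-equal tk tl (inj₁ (tt , tt)) λ { refl → k≢l refl }

    vv-unique : ∀ {i j j'} → T (vv i j) ≡ true → T (vv i j') ≡ true → j ≡ j'
    vv-unique {i} {j} {j'} tj tj' = decidable-stable (j ≟ j') λ j≢j' →
      together-equal tj tj' (inj₂ (i , inj₂ (j , refl) , inj₂ (j' , refl))) λ { refl → j≢j' refl }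

    m-gu-exclusive : ∀ {i k} → T (m i) ≡ true → T (gu k) ≢ true
    m-gu-exclusive ti tk = together-equal ti tk (inj₁ (tt , tt)) λ ()

    m-vv-exclusive : ∀ {i j} → T (m i) ≡ true → T (vv i j) ≢ true
    m-vv-exclusive {i} {j} ti tj = together-equal ti tj (inj₂ (i , inj₁ refl , inj₂ (j , refl))) λ ()

    omitted : Σ Class λ o → (∀ i → T (m i) ≡ does (o ≟ᶜ parᶜ i)) × (∀ k → T (gu k) ≡ does (o ≟ᶜ pathᶜ (suc k)))
    omitted with atMostOne⇒indicator (T ∘ m) m-unique
    ... | suc i , T-m = parᶜ i , T-m , λ k → Boolₚ.¬-not (m-gu-exclusive (trans (T-m i) (dec-true (i ≟ i) refl)))
    ... | zero  , T-m with atMostOne⇒indicator (T ∘ gu) gu-unique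
    ...   | c , T-gu = pathᶜ c , T-m , T-gu

    choice : ∀ i → Σ (Fin (suc (s i))) λ c → ∀ j → T (vv i j) ≡ does (c ≟ suc j)
    choice i = atMostOne⇒indicator (T ∘ vv i) vv-unique

    T≗stableOf : T ≗ stableOf (proj₁ omitted , proj₁ ∘ choice)
    T≗stableOf (m i)    = proj₁ (proj₂ omitted) i
    T≗stableOf (gu k)   = proj₂ (proj₂ omitted) k
    T≗stableOf (vv i j) with proj₁ omitted ≟ᶜ parᶜ i
    ... | yes o≡ = Boolₚ.¬-not (m-vv-exclusive (trans (proj₁ (proj₂ omitted) i) (dec-true (proj₁ omitted ≟ᶜ parᶜ i) o≡)))
    ... | no _   = proj₂ (choice i) j

    code : Σ Code λ c → T ≗ stableOf c
    code = (proj₁ omitted , proj₁ ∘ choice) , T≗stableOf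

  stableSets : Parametrisation Code (StableG n s p)
  stableSets = record
    { point   = stableOf
    ; point-∈ = stableOf-stable
    ; onto    = StableSetCode.code
    }

  toStable : GVert n s p → AffineForm (BEdge n s p)
  toStable (m i)    = const 1ℤ ⊖ sumᶠ (suc (s i)) (var ∘ par i)
  toStable (gu k)   = const 1ℤ ⊖ var (path (suc k))
  toStable (vv i j) = var (par i (suc j))

  toBasis : BEdge n s p → AffineForm (GVert n s p)
  toBasis (par i zero)    = const 1ℤ ⊖ var (m i) ⊖ sumᶠ (s i) (var ∘ vv i)
  toBasis (par i (suc j)) = var (vv i j)
  toBasis (path zero)     = sumᶠ n (var ∘ m) ⊕ sumᶠ p (var ∘ gu)
  toBasis (path (suc k))  = const 1ℤ ⊖ var (gu k)

  toStable-vertex : ∀ c → formMap toStable (χ (basisOf c)) ≗ χ (stableOf c)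
  toStable-vertex (o , ch) (m i) with o ≟ᶜ parᶜ i
  ... | yes _ = cong (λ t → 1ℚ - t) (∑-zero (suc (s i)) λ _ → refl)
  ... | no _  = cong (λ t → 1ℚ - t) (∑-indicator (ch i))
  toStable-vertex (o , ch) (gu k) with o ≟ᶜ pathᶜ (suc k)
  ... | yes _ = refl
  ... | no _  = refl
  toStable-vertex (o , ch) (vv i j) = refl

  toBasis-vertex : ∀ c → formMap toBasis (χ (stableOf c)) ≗ χ (basisOf c)
  toBasis-vertex (o , ch) (par i zero) with o ≟ᶜ parᶜ i | ch i
  ... | yes _ | _     = cong (λ t → (1ℚ - 1ℚ) - t) (∑-zero (s i) λ _ → refl)
  ... | no _  | zero  = cong (λ t → (1ℚ - 0ℚ) - t) (∑-zero (s i) λ _ → refl)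
  ... | no _  | suc c = cong (λ t → (1ℚ - 0ℚ) - t) (∑-indicator c)
  toBasis-vertex (o , ch) (par i (suc j)) = refl
  toBasis-vertex (parᶜ i , ch) (path zero) = cong₂ _+_ (∑-indicator i) (∑-zero p λ _ → refl)
  toBasis-vertex (pathᶜ zero , ch) (path zero) = cong₂ _+_ (∑-zero n λ _ → refl) (∑-zero p λ _ → refl)
  toBasis-vertex (pathᶜ (suc k) , ch) (path zero) = cong₂ _+_ (∑-zero n λ _ → refl) (∑-indicator k)
  toBasis-vertex (o , ch) (path (suc k)) with o ≟ᶜ pathᶜ (suc k)
  ... | yes _ = refl
  ... | no _  = refl

lemma4p3 : (n : ℕ) → 1 ≤ n → (s : Fin n → ℕ) → (∀ i → 1 ≤ s i) → (p : ℕ) →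
    UnimodEquiv (IsBasisM (𝓑 n s p)) (StableG n s p)
lemma4p3 n _ s _ p =
  unimodEquiv-byVertices
    (formMap-isLatticeAffine (toStable n s p)) (formMap-isLatticeAffine (toBasis n s p))
    (bases n s p) (stableSets n s p)
    (toStable-vertex n s p) (toBasis-vertex n s p)
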